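{- For all positive integers $d$, we have $[d-1]_4\in S(d,0)$.
   Context: $\mathrm{PG}_d(4)$ is the projective space of dimension $d$ over $\mathbb{F}_4$ (points: 1-dimensional subspaces of $\mathbb{F}_4^{d+1}$; lines: 2-dimensional subspaces, each with 5 points; hyperplanes: $d$-dimensional subspaces; a copy of $\mathrm{PG}_i(4)$ is the point set of an $(i+1)$-dimensional subspace). $[i]_4=1+4+\cdots+4^i$ for $i\ge0$ (so $[0]_4=1$). A legal truncation of $\mathrm{PG}_d(4)$ is the removal of a set of points such that no line retains exactly two points. For $i\in[0,d-1]$, $T(d,i)$ is the set of integers $n$ such that there is a legal truncation of $\mathrm{PG}_d(4)$ removing exactly $n$ points whose removed set meets some hyperplane in precisely a copy of $\mathrm{PG}_i(4)$. Define $S(d,i)=\{n-[i]_4: n\in T(d,i)\}$. -}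

module Defs where

open import Data.Nat using (ℕ; zero; suc; _+_; _^_)
open import Data.Bool using (Bool; true; false; _∧_; not; if_then_else_)
open import Data.Vec using (Vec; []; _∷_; zipWith; replicate; map)
open import Data.List using (List; []; _∷_; concatMap; filterᵇ; length)
open import Data.Bool.ListAction using (any)
open import Relation.Binary.PropositionalEquality using (_≡_; _≢_)
open import Data.Product using (Σ; _×_; _,_)

-- The field F₄ = {0, 1, ω, ω²} with ω² = ω + 1.

data F4 : Set where
  O I w w² : F4

_+F_ : F4 → F4 → F4
O  +F y  = y
x  +F O  = x
I  +F I  = O
I  +F w  = w²
I  +F w² = w
w  +F I  = w²
w  +F w  = O
w  +F w² = I
w² +F I  = w
w² +F w  = I
w² +F w² = O

_*F_ : F4 → F4 → F4
O  *F y  = O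
x  *F O  = O
I  *F y  = y
x  *F I  = x
w  *F w  = w²
w  *F w² = I
w² *F w  = I
w² *F w² = w

_==F_ : F4 → F4 → Bool
O  ==F O  = true
I  ==F I  = true
w  ==F w  = true
w² ==F w² = true
_  ==F _  = false

allF4 : List F4
allF4 = O ∷ I ∷ w ∷ w² ∷ []

zeroV : (n : ℕ) → Vec F4 n
zeroV n = replicate n O

_+V_ : {n : ℕ} → Vec F4 n → Vec F4 n → Vec F4 n
_+V_ = zipWith _+F_

_·V_ : {n : ℕ} → F4 → Vec F4 n → Vec F4 n
a ·V v = map (a *F_) v

_==V_ : {n : ℕ} → Vec F4 n → Vec F4 n → Bool
[]       ==V []       = true
(x ∷ xs) ==V (y ∷ ys) = (x ==F y) ∧ (xs ==V ys)

allVecs : (n : ℕ) → List (Vec F4 n)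
allVecs zero    = [] ∷ []
allVecs (suc n) = concatMap (λ a → Data.List.map (a ∷_) (allVecs n)) allF4

lincomb : {n k : ℕ} → Vec F4 k → Vec (Vec F4 n) k → Vec F4 n
lincomb {n} []       []       = zeroV n
lincomb     (c ∷ cs) (v ∷ vs) = (c ·V v) +V lincomb cs vs

LinIndep : {n k : ℕ} → Vec (Vec F4 n) k → Set
LinIndep {n} {k} vs = (c : Vec F4 k) → lincomb c vs ≡ zeroV n → c ≡ zeroV k

inSpan : {n k : ℕ} → Vec (Vec F4 n) k → Vec F4 n → Bool
inSpan {n} {k} vs x = any (λ c → lincomb c vs ==V x) (allVecs k)

-- Points of PG_d(4): each 1-dimensional subspace of F₄^{d+1} is represented
-- by its unique normalised spanning vector (first nonzero coordinate = 1).

isPoint : {n : ℕ} → Vec F4 n → Bool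
isPoint []       = false
isPoint (O ∷ xs) = isPoint xs
isPoint (I ∷ xs) = true
isPoint (w ∷ xs) = false
isPoint (w² ∷ xs) = false

points : (d : ℕ) → List (Vec F4 (suc d))
points d = filterᵇ (λ x → isPoint x) (allVecs (suc d))

-- A set of points of PG_d(4) is a Boolean predicate on (normalised) vectors;
-- only its values on 'points d' matter.
PointSet : ℕ → Set
PointSet d = Vec F4 (suc d) → Bool

card : (d : ℕ) → PointSet d → ℕ
card d R = length (filterᵇ (λ x → R x) (points d))

retainedOn : (d : ℕ) {k : ℕ} → PointSet d → Vec (Vec F4 (suc d)) k → ℕ
retainedOn d R vs = length (filterᵇ (λ x → inSpan vs x ∧ not (R x)) (points d))

-- Legal truncation: removing the point set R, no line (2-dim subspace,
-- spanned by two linearly independent vectors) retains exactly two points.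
LegalTruncation : (d : ℕ) → PointSet d → Set
LegalTruncation d R =
  (L : Vec (Vec F4 (suc d)) 2) → LinIndep L → retainedOn d R L ≢ 2

[_]₄ : ℕ → ℕ
[ zero ]₄  = 1
[ suc i ]₄ = [ i ]₄ + 4 ^ suc i

-- The removed set R meets some hyperplane (d-dim subspace) in precisely the
-- point set of a copy of PG_i(4) (an (i+1)-dim subspace).
MeetsHyperplaneIn : (d i : ℕ) → PointSet d → Set
MeetsHyperplaneIn d i R =
  Σ (Vec (Vec F4 (suc d)) d) λ H → LinIndep H ×
  Σ (Vec (Vec F4 (suc d)) (suc i)) λ P → LinIndep P ×
  ((x : Vec F4 (suc d)) → isPoint x ≡ true →
     (R x ∧ inSpan H x) ≡ inSpan P x)

InT : (d i n : ℕ) → Set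
InT d i n = Σ (PointSet d) λ R →
  LegalTruncation d R × card d R ≡ n × MeetsHyperplaneIn d i R

InS : (d i m : ℕ) → Set
InS d i m = InT d i (m + [ i ]₄)

module Submission where

-- Write d = m + 1.  The removed set R_m ⊆ PG_{m+1}(4) is built by induction on m:
--   R_0 = {(1:0), (1:1)},   R_m = {(0:y) : y ∈ R_{m-1}} ∪ {(1:y) : last y = 1}.
-- Hence |R_m| = |R_{m-1}| + 4^m = [m]₄ + 1, and R_m meets the hyperplane
-- "last coordinate = 0" exactly in the point e = (0:…:0:1:0).  PG_1(4) is one line keeping 3 points (a
-- finite check).  In PG_{m+1}(4) a line inside x₀ = 0 is a line of PG_m(4) keeping
-- the same points.  Any other line has a basis (1:u), (0:v); its points are (0:v)
-- and the affine points (1 : u + t·v), the latter removed iff α + t·β = 1, where α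
-- and β are the last coordinates of u and v.  Either at most one t is removed, so at
-- least 3 points are kept, or (α,β) = (1,0) and at most the point (0:v) is kept.

open import Defs
open import Data.Nat using (ℕ; zero; suc; _+_; _^_; _≤_; _∸_; _≡ᵇ_; z≤n; s≤s)
open import Data.Nat.Properties using (+-identityʳ; +-assoc; +-comm; m≤n⇒m≤1+n; <⇒≢)
open import Data.Bool using (Bool; true; false; _∧_; _∨_; not; T)
open import Data.Bool.Properties using (∧-conicalˡ; ∧-conicalʳ; T-≡; ⇔→≡; ¬-not)
open import Data.Bool.ListAction using (any; all)
open import Data.Unit using (tt)
open import Data.Empty using (⊥; ⊥-elim)
open import Data.Product using (Σ; _×_; _,_; proj₁; proj₂)
import Data.Vec
open import Data.Vec using (Vec; []; _∷_; zipWith; replicate; _∷ʳ_)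
open import Data.Vec.Properties using (∷-injectiveˡ; ∷-injectiveʳ)
import Data.List as List
open import Data.List using (List; []; _∷_; _++_; length; filterᵇ; concatMap)
open import Data.List.Properties using (filter-++; filter-≐; length-++)
open import Data.List.Membership.Propositional using (_∈_; lose)
open import Data.List.Membership.Propositional.Properties
  using (∈-map⁺; ∈-map⁻; ∈-concatMap⁺; ∈-filter⁺; ∈-filter⁻; ∈-length)
open import Data.List.Relation.Unary.Any using (here; there; satisfied)
open import Data.List.Relation.Unary.Any.Properties using (any⁺; any⁻)
import Data.List.Relation.Unary.All as All
open import Data.List.Relation.Unary.All using ([]; _∷_)
import Data.List.Relation.Unary.All.Properties as All
import Data.List.Relation.Unary.AllPairs as AllPairs
open import Data.List.Relation.Unary.AllPairs using ([]; _∷_)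
import Data.List.Relation.Unary.AllPairs.Properties as AllPairs
open import Data.List.Relation.Unary.Unique.Propositional using (Unique)
import Data.List.Relation.Unary.Unique.Propositional.Properties as Unique
open import Data.List.Relation.Binary.Disjoint.Propositional using (Disjoint)
open import Function using (_∘_)
open import Function.Bundles using (Equivalence; mk⇔; _⇔_)
open import Relation.Binary.PropositionalEquality
open import Relation.Nullary using (Dec; yes; no; ¬_; contradiction)
open import Relation.Nullary.Decidable using (T?)
open ≡-Reasoning


==F-sound : ∀ {x y} → (x ==F y) ≡ true → x ≡ y
==F-sound {O}  {O}  _ = refl
==F-sound {I}  {I}  _ = refl
==F-sound {w}  {w}  _ = refl
==F-sound {w²} {w²} _ = refl

==F-refl : ∀ x → (x ==F x) ≡ true
==F-refl O  = refl
==F-refl I  = refl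
==F-refl w  = refl
==F-refl w² = refl

_≟F_ : (x y : F4) → Dec (x ≡ y)
x ≟F y with x ==F y in eq
... | true  = yes (==F-sound eq)
... | false = no λ { refl → true≢false (trans (sym (==F-refl x)) eq) }
  where
    true≢false : true ≢ false
    true≢false ()

-- Since F₄ is finite, an identity in F₄ holds as soon as it holds at every
-- element; 'every' evaluates a Boolean property at all four of them.
every : (F4 → Bool) → Bool
every f = f O ∧ (f I ∧ (f w ∧ f w²))

every-sound : ∀ f → every f ≡ true → ∀ x → f x ≡ true
every-sound f h O  = ∧-conicalˡ (f O) _ h
every-sound f h I  = ∧-conicalˡ (f I) _ (∧-conicalʳ (f O) _ h)
every-sound f h w  = ∧-conicalˡ (f w) _ (∧-conicalʳ (f I) _ (∧-conicalʳ (f O) _ h))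
every-sound f h w² = ∧-conicalʳ (f w) _ (∧-conicalʳ (f I) _ (∧-conicalʳ (f O) _ h))

identity₂ : (f g : F4 → F4 → F4) →
            every (λ x → every (λ y → f x y ==F g x y)) ≡ true →
            ∀ x y → f x y ≡ g x y
identity₂ f g h x y =
  ==F-sound (every-sound (λ y → f x y ==F g x y)
              (every-sound (λ x → every (λ y → f x y ==F g x y)) h x) y)

identity₃ : (f g : F4 → F4 → F4 → F4) →
            every (λ x → every (λ y → every (λ z → f x y z ==F g x y z))) ≡ true →
            ∀ x y z → f x y z ≡ g x y z
identity₃ f g h x y z =
  ==F-sound (every-sound (λ z → f x y z ==F g x y z)
              (every-sound (λ y → every (λ z → f x y z ==F g x y z))
                (every-sound (λ x → every (λ y → every (λ z → f x y z ==F g x y z))) h x) y) z)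

+F-identityʳ : ∀ x → x +F O ≡ x
+F-identityʳ O  = refl
+F-identityʳ I  = refl
+F-identityʳ w  = refl
+F-identityʳ w² = refl

+F-self : ∀ x → x +F x ≡ O
+F-self O  = refl
+F-self I  = refl
+F-self w  = refl
+F-self w² = refl

+F-comm : ∀ x y → x +F y ≡ y +F x
+F-comm = identity₂ (λ x y → x +F y) (λ x y → y +F x) refl

+F-assoc : ∀ x y z → (x +F y) +F z ≡ x +F (y +F z)
+F-assoc = identity₃ (λ x y z → (x +F y) +F z) (λ x y z → x +F (y +F z)) refl

*F-zeroʳ : ∀ x → x *F O ≡ O
*F-zeroʳ O  = refl
*F-zeroʳ I  = refl
*F-zeroʳ w  = refl
*F-zeroʳ w² = refl

*F-identityˡ : ∀ x → I *F x ≡ x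
*F-identityˡ O  = refl
*F-identityˡ I  = refl
*F-identityˡ w  = refl
*F-identityˡ w² = refl

*F-identityʳ : ∀ x → x *F I ≡ x
*F-identityʳ O  = refl
*F-identityʳ I  = refl
*F-identityʳ w  = refl
*F-identityʳ w² = refl

*F-assoc : ∀ x y z → (x *F y) *F z ≡ x *F (y *F z)
*F-assoc = identity₃ (λ x y z → (x *F y) *F z) (λ x y z → x *F (y *F z)) refl

*F-distribˡ : ∀ x y z → x *F (y +F z) ≡ (x *F y) +F (x *F z)
*F-distribˡ = identity₃ (λ x y z → x *F (y +F z)) (λ x y z → (x *F y) +F (x *F z)) refl

*F-distribʳ : ∀ x y z → (y +F z) *F x ≡ (y *F x) +F (z *F x)
*F-distribʳ = identity₃ (λ x y z → (y +F z) *F x) (λ x y z → (y *F x) +F (z *F x)) refl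

-- Multiplicative inverse (with inv O = O).
inv : F4 → F4
inv O  = O
inv I  = I
inv w  = w²
inv w² = w

*F-inverseˡ : ∀ {x} → x ≢ O → inv x *F x ≡ I
*F-inverseˡ {O}  x≢O = ⊥-elim (x≢O refl)
*F-inverseˡ {I}  _   = refl
*F-inverseˡ {w}  _   = refl
*F-inverseˡ {w²} _   = refl

*F-inverseʳ : ∀ {x} → x ≢ O → x *F inv x ≡ I
*F-inverseʳ {O}  x≢O = ⊥-elim (x≢O refl)
*F-inverseʳ {I}  _   = refl
*F-inverseʳ {w}  _   = refl
*F-inverseʳ {w²} _   = refl

+F-interchange : ∀ a b c d → (a +F b) +F (c +F d) ≡ (a +F c) +F (b +F d)
+F-interchange a b c d = begin
  (a +F b) +F (c +F d)  ≡⟨ +F-assoc a b (c +F d) ⟩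
  a +F (b +F (c +F d))  ≡⟨ cong (a +F_) (+F-assoc b c d) ⟨
  a +F ((b +F c) +F d)  ≡⟨ cong (λ z → a +F (z +F d)) (+F-comm b c) ⟩
  a +F ((c +F b) +F d)  ≡⟨ cong (a +F_) (+F-assoc c b d) ⟩
  a +F (c +F (b +F d))  ≡⟨ +F-assoc a c (b +F d) ⟨
  (a +F c) +F (b +F d)  ∎

+F-cancelˡ : ∀ x {a b} → x +F a ≡ x +F b → a ≡ b
+F-cancelˡ x {a} {b} e = begin
  a              ≡⟨ cong (_+F a) (+F-self x) ⟨
  (x +F x) +F a  ≡⟨ +F-assoc x x a ⟩
  x +F (x +F a)  ≡⟨ cong (x +F_) e ⟩
  x +F (x +F b)  ≡⟨ +F-assoc x x b ⟨
  (x +F x) +F b  ≡⟨ cong (_+F b) (+F-self x) ⟩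
  b              ∎

*F-cancelʳ : ∀ {y} → y ≢ O → ∀ {a b} → a *F y ≡ b *F y → a ≡ b
*F-cancelʳ {y} y≢O {a} {b} e = begin
  a                  ≡⟨ *F-identityʳ a ⟨
  a *F I             ≡⟨ cong (a *F_) (*F-inverseʳ y≢O) ⟨
  a *F (y *F inv y)  ≡⟨ *F-assoc a y (inv y) ⟨
  (a *F y) *F inv y  ≡⟨ cong (_*F inv y) e ⟩
  (b *F y) *F inv y  ≡⟨ *F-assoc b y (inv y) ⟩
  b *F (y *F inv y)  ≡⟨ cong (b *F_) (*F-inverseʳ y≢O) ⟩
  b *F I             ≡⟨ *F-identityʳ b ⟩
  b                  ∎


lin2 : ∀ {n} → F4 → F4 → Vec F4 n → Vec F4 n → Vec F4 n
lin2 s t = zipWith (λ x y → (s *F x) +F (t *F y))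

lincomb-pair : ∀ {n} s t (a b : Vec F4 n) → lincomb (s ∷ t ∷ []) (a ∷ b ∷ []) ≡ lin2 s t a b
lincomb-pair s t []      []      = refl
lincomb-pair s t (x ∷ a) (y ∷ b) =
  cong₂ _∷_ (cong ((s *F x) +F_) (+F-identityʳ (t *F y))) (lincomb-pair s t a b)

regroup : ∀ s t p q p' q' x y →
          (s *F ((p *F x) +F (q *F y))) +F (t *F ((p' *F x) +F (q' *F y)))
          ≡ (((s *F p) +F (t *F p')) *F x) +F (((s *F q) +F (t *F q')) *F y)
regroup s t p q p' q' x y = begin
  (s *F ((p *F x) +F (q *F y))) +F (t *F ((p' *F x) +F (q' *F y)))
    ≡⟨ cong₂ _+F_ (*F-distribˡ s _ _) (*F-distribˡ t _ _) ⟩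
  ((s *F (p *F x)) +F (s *F (q *F y))) +F ((t *F (p' *F x)) +F (t *F (q' *F y)))
    ≡⟨ +F-interchange (s *F (p *F x)) (s *F (q *F y)) (t *F (p' *F x)) (t *F (q' *F y)) ⟩
  ((s *F (p *F x)) +F (t *F (p' *F x))) +F ((s *F (q *F y)) +F (t *F (q' *F y)))
    ≡⟨ cong₂ _+F_ (cong₂ _+F_ (*F-assoc s p x) (*F-assoc t p' x))
                  (cong₂ _+F_ (*F-assoc s q y) (*F-assoc t q' y)) ⟨
  (((s *F p) *F x) +F ((t *F p') *F x)) +F (((s *F q) *F y) +F ((t *F q') *F y))
    ≡⟨ cong₂ _+F_ (*F-distribʳ x (s *F p) (t *F p')) (*F-distribʳ y (s *F q) (t *F q')) ⟨
  (((s *F p) +F (t *F p')) *F x) +F (((s *F q) +F (t *F q')) *F y) ∎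

lin2-lin2 : ∀ {n} s t p q p' q' (a b : Vec F4 n) →
            lin2 s t (lin2 p q a b) (lin2 p' q' a b)
            ≡ lin2 ((s *F p) +F (t *F p')) ((s *F q) +F (t *F q')) a b
lin2-lin2 s t p q p' q' []      []      = refl
lin2-lin2 s t p q p' q' (x ∷ a) (y ∷ b) =
  cong₂ _∷_ (regroup s t p q p' q' x y) (lin2-lin2 s t p q p' q' a b)

lin2-IO : ∀ {n} (a b : Vec F4 n) → lin2 I O a b ≡ a
lin2-IO []      []      = refl
lin2-IO (x ∷ a) (y ∷ b) = cong₂ _∷_ (trans (+F-identityʳ (I *F x)) (*F-identityˡ x)) (lin2-IO a b)

lin2-OI : ∀ {n} (a b : Vec F4 n) → lin2 O I a b ≡ b
lin2-OI []      []      = refl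
lin2-OI (x ∷ a) (y ∷ b) = cong₂ _∷_ (*F-identityˡ y) (lin2-OI a b)

lin2-swap : ∀ {n} s t (a b : Vec F4 n) → lin2 s t a b ≡ lin2 t s b a
lin2-swap s t []      []      = refl
lin2-swap s t (x ∷ a) (y ∷ b) = cong₂ _∷_ (+F-comm (s *F x) (t *F y)) (lin2-swap s t a b)

lin2-zeroˡ : ∀ {n} t (u v : Vec F4 n) → lin2 O t u v ≡ t ·V v
lin2-zeroˡ t []      []      = refl
lin2-zeroˡ t (x ∷ u) (y ∷ v) = cong (t *F y ∷_) (lin2-zeroˡ t u v)

-- The last coordinate; recursion on the length makes lastCoord (c ∷ y) reduce.
lastCoord : ∀ {n} → Vec F4 (suc n) → F4
lastCoord {zero}  (x ∷ [])  = x
lastCoord {suc n} (x ∷ xs) = lastCoord xs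

lastCoord-lin2 : ∀ {n} s t (a b : Vec F4 (suc n)) →
                 lastCoord (lin2 s t a b) ≡ (s *F lastCoord a) +F (t *F lastCoord b)
lastCoord-lin2 {zero}  s t (x ∷ []) (y ∷ []) = refl
lastCoord-lin2 {suc n} s t (x ∷ a)  (y ∷ b)  = lastCoord-lin2 s t a b

lin2-injectiveʳ : ∀ {n} s {t t'} (u v : Vec F4 n) → v ≢ replicate n O →
                  lin2 s t u v ≡ lin2 s t' u v → t ≡ t'
lin2-injectiveʳ s []      []      v≢0 _ = ⊥-elim (v≢0 refl)
lin2-injectiveʳ s (x ∷ u) (y ∷ v) v≢0 e with y ≟F O
... | yes refl = lin2-injectiveʳ s u v (λ v≡0 → v≢0 (cong (O ∷_) v≡0)) (∷-injectiveʳ e)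
... | no y≢O   = *F-cancelʳ y≢O (+F-cancelˡ (s *F x) (∷-injectiveˡ e))


zero-multiple-not-point : ∀ {n} (v : Vec F4 n) → isPoint (O ·V v) ≢ true
zero-multiple-not-point []      = λ ()
zero-multiple-not-point (x ∷ v) = zero-multiple-not-point v

leading-one : ∀ {n} a y (v : Vec F4 n) → y ≢ O →
              isPoint ((a *F y) ∷ (a ·V v)) ≡ true → a *F y ≡ I
leading-one a y v y≢O p with a *F y in ay
... | I  = refl
... | w  = contradiction p λ ()
... | w² = contradiction p λ ()
... | O  = ⊥-elim (zero-multiple-not-point v
                     (subst (λ c → isPoint (c ·V v) ≡ true) (*F-cancelʳ y≢O {a} {O} ay) p))

normalised-unique : ∀ {n} a b (v : Vec F4 n) →
                    isPoint (a ·V v) ≡ true → isPoint (b ·V v) ≡ true → a ·V v ≡ b ·V v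
normalised-unique a b (y ∷ v) pa pb with y ≟F O
... | yes refl = cong₂ _∷_ (trans (*F-zeroʳ a) (sym (*F-zeroʳ b)))
                           (normalised-unique a b v (tail-point a pa) (tail-point b pb))
  where
    tail-point : ∀ c → isPoint ((c *F O) ∷ (c ·V v)) ≡ true → isPoint (c ·V v) ≡ true
    tail-point c = subst (λ h → isPoint (h ∷ (c ·V v)) ≡ true) (*F-zeroʳ c)
... | no y≢O   = cong (λ c → c ·V (y ∷ v))
                   (*F-cancelʳ y≢O {a} {b} (trans (leading-one a y v y≢O pa) (sym (leading-one b y v y≢O pb))))


allF4-complete : ∀ c → c ∈ allF4
allF4-complete O  = here refl
allF4-complete I  = there (here refl)
allF4-complete w  = there (there (here refl))
allF4-complete w² = there (there (there (here refl)))

allF4-unique : Unique allF4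
allF4-unique = ((λ ()) ∷ (λ ()) ∷ (λ ()) ∷ []) ∷ ((λ ()) ∷ (λ ()) ∷ []) ∷ ((λ ()) ∷ []) ∷ [] ∷ []

allVecs-complete : ∀ n (v : Vec F4 n) → v ∈ allVecs n
allVecs-complete zero    []      = here refl
allVecs-complete (suc n) (c ∷ v) =
  ∈-concatMap⁺ (λ a → List.map (a ∷_) (allVecs n))
    (lose (allF4-complete c) (∈-map⁺ (c ∷_) (allVecs-complete n v)))

blocks-disjoint : ∀ {n} (xs : List (Vec F4 n)) {a b} → a ≢ b →
                  Disjoint (List.map (a ∷_) xs) (List.map (b ∷_) xs)
blocks-disjoint xs a≢b (p , q) with ∈-map⁻ (_ ∷_) p | ∈-map⁻ (_ ∷_) q
... | _ , _ , refl | _ , _ , e = a≢b (∷-injectiveˡ e)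

allVecs-unique : ∀ n → Unique (allVecs n)
allVecs-unique zero    = [] ∷ []
allVecs-unique (suc n) =
  Unique.concat⁺ (All.map⁺ (All.universal (λ c → Unique.map⁺ {f = c ∷_} ∷-injectiveʳ (allVecs-unique n)) allF4))
                 (AllPairs.map⁺ {f = λ c → List.map (c ∷_) (allVecs n)}
                   (AllPairs.map (blocks-disjoint (allVecs n)) allF4-unique))

points-complete : ∀ {d} {x : Vec F4 (suc d)} → isPoint x ≡ true → x ∈ points d
points-complete {d} {x} p = ∈-filter⁺ (T? ∘ isPoint) (allVecs-complete (suc d) x) (Equivalence.from T-≡ p)

points-unique : ∀ d → Unique (points d)
points-unique d = Unique.filter⁺ (T? ∘ isPoint) (allVecs-unique (suc d))


==V-sound : ∀ {n} {u v : Vec F4 n} → (u ==V v) ≡ true → u ≡ v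
==V-sound {u = []}    {[]}    _ = refl
==V-sound {u = x ∷ u} {y ∷ v} e =
  cong₂ _∷_ (==F-sound (∧-conicalˡ (x ==F y) _ e)) (==V-sound (∧-conicalʳ (x ==F y) _ e))

==V-refl : ∀ {n} (u : Vec F4 n) → (u ==V u) ≡ true
==V-refl []      = refl
==V-refl (x ∷ u) rewrite ==F-refl x = ==V-refl u

inSpan-sound : ∀ {n k} (vs : Vec (Vec F4 n) k) {x} → inSpan vs x ≡ true →
               Σ (Vec F4 k) λ c → lincomb c vs ≡ x
inSpan-sound {k = k} vs {x} e
  with satisfied (any⁻ (λ c → lincomb c vs ==V x) (allVecs k) (Equivalence.from T-≡ e))
... | c , h = c , ==V-sound (Equivalence.to T-≡ h)

inSpan-complete : ∀ {n k} (vs : Vec (Vec F4 n) k) c → inSpan vs (lincomb c vs) ≡ true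
inSpan-complete {k = k} vs c =
  Equivalence.to T-≡ (any⁺ (λ c' → lincomb c' vs ==V lincomb c vs)
    (lose (allVecs-complete k c) (Equivalence.from T-≡ (==V-refl (lincomb c vs)))))

+V-identityʳ : ∀ {n} (x : Vec F4 n) → x +V zeroV n ≡ x
+V-identityʳ []      = refl
+V-identityʳ (y ∷ x) = cong₂ _∷_ (+F-identityʳ y) (+V-identityʳ x)

·V-identityˡ : ∀ {n} (x : Vec F4 n) → I ·V x ≡ x
·V-identityˡ []      = refl
·V-identityˡ (y ∷ x) = cong₂ _∷_ (*F-identityˡ y) (·V-identityˡ x)

span1-point : ∀ {n} {v x : Vec F4 n} → isPoint v ≡ true → isPoint x ≡ true →
              inSpan (v ∷ []) x ≡ true → x ≡ v
span1-point {v = v} pv px e with inSpan-sound (v ∷ []) e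
... | c ∷ [] , refl = begin
  (c ·V v) +V zeroV _  ≡⟨ +V-identityʳ (c ·V v) ⟩
  c ·V v               ≡⟨ normalised-unique c I v (subst (λ z → isPoint z ≡ true) (+V-identityʳ (c ·V v)) px)
                                                     (subst (λ z → isPoint z ≡ true) (sym (·V-identityˡ v)) pv) ⟩
  I ·V v               ≡⟨ ·V-identityˡ v ⟩
  v                    ∎

span1-self : ∀ {n} (v : Vec F4 n) → inSpan (v ∷ []) v ≡ true
span1-self v = subst (λ z → inSpan (v ∷ []) z ≡ true) (trans (+V-identityʳ (I ·V v)) (·V-identityˡ v))
                     (inSpan-complete (v ∷ []) (I ∷ []))

point-independent : ∀ {n} {v : Vec F4 n} → isPoint v ≡ true → LinIndep (v ∷ [])
point-independent {v = v} pv (c ∷ []) e = cong (_∷ []) (scalar-zero v pv (trans (sym (+V-identityʳ (c ·V v))) e))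
  where
    scalar-zero : ∀ {n} (v : Vec F4 n) → isPoint v ≡ true → c ·V v ≡ zeroV n → c ≡ O
    scalar-zero (O ∷ v) p e = scalar-zero v p (∷-injectiveʳ e)
    scalar-zero (I ∷ v) p e = trans (sym (*F-identityʳ c)) (∷-injectiveˡ e)

span2-sound : ∀ {n} (a b : Vec F4 n) {x} → inSpan (a ∷ b ∷ []) x ≡ true →
              Σ F4 λ s → Σ F4 λ t → lin2 s t a b ≡ x
span2-sound a b e with inSpan-sound (a ∷ b ∷ []) e
... | (s ∷ t ∷ []) , lc = s , t , trans (sym (lincomb-pair s t a b)) lc

span2-complete : ∀ {n} (a b : Vec F4 n) s t → inSpan (a ∷ b ∷ []) (lin2 s t a b) ≡ true
span2-complete a b s t =
  subst (λ x → inSpan (a ∷ b ∷ []) x ≡ true) (lincomb-pair s t a b) (inSpan-complete (a ∷ b ∷ []) (s ∷ t ∷ []))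

SameSpan : ∀ {n} → Vec (Vec F4 n) 2 → Vec (Vec F4 n) 2 → Set
SameSpan L L' = ∀ x → inSpan L x ≡ inSpan L' x

span-⊆ : ∀ {n} {a b u v : Vec F4 n} p q p' q' → u ≡ lin2 p q a b → v ≡ lin2 p' q' a b →
         ∀ {x} → inSpan (u ∷ v ∷ []) x ≡ true → inSpan (a ∷ b ∷ []) x ≡ true
span-⊆ {a = a} {b} {u} {v} p q p' q' refl refl e with span2-sound u v e
... | s , t , refl = subst (λ x → inSpan (a ∷ b ∷ []) x ≡ true) (sym (lin2-lin2 s t p q p' q' a b))
                           (span2-complete a b ((s *F p) +F (t *F p')) ((s *F q) +F (t *F q')))

same-span : ∀ {n} {a b u v : Vec F4 n} p q p' q' r s r' s' →
            u ≡ lin2 p q a b → v ≡ lin2 p' q' a b → a ≡ lin2 r s u v → b ≡ lin2 r' s' u v →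
            SameSpan (a ∷ b ∷ []) (u ∷ v ∷ [])
same-span p q p' q' r s r' s' hu hv ha hb x =
  ⇔→≡ (mk⇔ (span-⊆ r s r' s' ha hb) (span-⊆ p q p' q' hu hv))

swap-span : ∀ {n} (a b : Vec F4 n) → SameSpan (a ∷ b ∷ []) (b ∷ a ∷ [])
swap-span a b = same-span O I I O O I I O (sym (lin2-OI a b)) (sym (lin2-IO a b))
                                          (sym (lin2-OI b a)) (sym (lin2-IO b a))

swap-independent : ∀ {n} {a b : Vec F4 n} → LinIndep (a ∷ b ∷ []) → LinIndep (b ∷ a ∷ [])
swap-independent {a = a} {b} li (s ∷ t ∷ []) e
  with li (t ∷ s ∷ []) (trans (lincomb-pair t s a b)
                         (trans (lin2-swap t s a b) (trans (sym (lincomb-pair s t b a)) e)))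
... | refl = refl


count : ∀ {A : Set} → (A → Bool) → List A → ℕ
count p xs = length (filterᵇ p xs)

count-++ : ∀ {A : Set} (p : A → Bool) xs ys → count p (xs ++ ys) ≡ count p xs + count p ys
count-++ p xs ys = trans (cong length (filter-++ (T? ∘ p) xs ys)) (length-++ (filterᵇ p xs))

count-map : ∀ {A B : Set} (p : B → Bool) (f : A → B) xs → count p (List.map f xs) ≡ count (p ∘ f) xs
count-map p f []       = refl
count-map p f (x ∷ xs) with p (f x)
... | true  = cong suc (count-map p f xs)
... | false = count-map p f xs

count-cong : ∀ {A : Set} {p q : A → Bool} → (∀ x → p x ≡ q x) → ∀ xs → count p xs ≡ count q xs
count-cong {p = p} {q} p≗q xs =
  cong length (filter-≐ (T? ∘ p) (T? ∘ q)
                 ((λ {x} → subst T (p≗q x)) , (λ {x} → subst T (sym (p≗q x)))) xs)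

count-none : ∀ {A : Set} {p : A → Bool} → (∀ x → p x ≡ false) → ∀ xs → count p xs ≡ 0
count-none {p = p} none xs = trans (count-cong none xs) (count-false xs)
  where
    count-false : ∀ xs → count (λ _ → false) xs ≡ 0
    count-false []       = refl
    count-false (_ ∷ xs) = count-false xs

count-filter : ∀ {A : Set} (p q : A → Bool) xs → count p (filterᵇ q xs) ≡ count (λ x → q x ∧ p x) xs
count-filter p q []       = refl
count-filter p q (x ∷ xs) with q x
... | false = count-filter p q xs
... | true with p x
...   | true  = cong suc (count-filter p q xs)
...   | false = count-filter p q xs

count-allVecs-suc : ∀ {n} (p : Vec F4 (suc n) → Bool) →
  count p (allVecs (suc n))
  ≡ count (λ y → p (O ∷ y)) (allVecs n) + (count (λ y → p (I ∷ y)) (allVecs n)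
    + (count (λ y → p (w ∷ y)) (allVecs n) + (count (λ y → p (w² ∷ y)) (allVecs n) + 0)))
count-allVecs-suc {n} p = by-first-coordinate allF4
  where
    by-first-coordinate : ∀ cs → count p (concatMap (λ c → List.map (c ∷_) (allVecs n)) cs)
                                 ≡ List.foldr (λ c r → count (λ y → p (c ∷ y)) (allVecs n) + r) 0 cs
    by-first-coordinate []       = refl
    by-first-coordinate (c ∷ cs) =
      trans (count-++ p (List.map (c ∷_) (allVecs n)) _)
            (cong₂ _+_ (count-map p (c ∷_) (allVecs n)) (by-first-coordinate cs))

count-points-suc : ∀ {n} (p : Vec F4 (suc (suc n)) → Bool) →
  count p (points (suc n)) ≡ count (λ y → p (O ∷ y)) (points n) + count (λ y → p (I ∷ y)) (allVecs (suc n))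
count-points-suc {n} p = begin
  count p (points (suc n))
    ≡⟨ count-filter p isPoint (allVecs (suc (suc n))) ⟩
  count (λ x → isPoint x ∧ p x) (allVecs (suc (suc n)))
    ≡⟨ count-allVecs-suc (λ x → isPoint x ∧ p x) ⟩
  countO + (countI + (count (λ _ → false) V + (count (λ _ → false) V + 0)))
    ≡⟨ cong (λ k → countO + (countI + (k + (k + 0)))) (count-none (λ _ → refl) V) ⟩
  countO + (countI + 0)
    ≡⟨ cong₂ _+_ (sym (count-filter (λ y → p (O ∷ y)) isPoint V)) (+-identityʳ countI) ⟩
  count (λ y → p (O ∷ y)) (points n) + countI ∎
  where
    V = allVecs (suc n)
    countO = count (λ y → isPoint y ∧ p (O ∷ y)) V
    countI = count (λ y → p (I ∷ y)) V

two-distinct : ∀ {A : Set} {x y : A} {xs} → x ∈ xs → y ∈ xs → x ≢ y → 2 ≤ length xs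
two-distinct (here refl) (here refl) x≢y = ⊥-elim (x≢y refl)
two-distinct (here refl) (there y∈)  _   = s≤s (∈-length y∈)
two-distinct (there x∈)  (here refl) _   = s≤s (∈-length x∈)
two-distinct (there x∈)  (there y∈)  x≢y = m≤n⇒m≤1+n (two-distinct x∈ y∈ x≢y)

three-distinct : ∀ {A : Set} {x y z : A} {xs} → x ∈ xs → y ∈ xs → z ∈ xs →
                 x ≢ y → x ≢ z → y ≢ z → 3 ≤ length xs
three-distinct (here refl) (here refl) _           x≢y _   _   = ⊥-elim (x≢y refl)
three-distinct (here refl) (there y∈)  (here refl) _   x≢z _   = ⊥-elim (x≢z refl)
three-distinct (here refl) (there y∈)  (there z∈)  _   _   y≢z = s≤s (two-distinct y∈ z∈ y≢z)
three-distinct (there x∈)  (here refl) (here refl) _   _   y≢z = ⊥-elim (y≢z refl)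
three-distinct (there x∈)  (here refl) (there z∈)  _   x≢z _   = s≤s (two-distinct x∈ z∈ x≢z)
three-distinct (there x∈)  (there y∈)  (here refl) x≢y _   _   = s≤s (two-distinct x∈ y∈ x≢y)
three-distinct (there x∈)  (there y∈)  (there z∈)  x≢y x≢z y≢z =
  m≤n⇒m≤1+n (three-distinct x∈ y∈ z∈ x≢y x≢z y≢z)

at-most-one : ∀ {A : Set} {xs : List A} → Unique xs → (∀ {x y} → x ∈ xs → y ∈ xs → x ≡ y) → length xs ≤ 1
at-most-one {xs = []}        _               _    = z≤n
at-most-one {xs = _ ∷ []}    _               _    = s≤s z≤n
at-most-one {xs = _ ∷ _ ∷ _} ((x≢y ∷ _) ∷ _) all≡ = ⊥-elim (x≢y (all≡ (here refl) (there (here refl))))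


removed : (m : ℕ) → PointSet (suc m)
removed zero    (a ∷ b ∷ []) = (a ==F I) ∧ ((b ==F O) ∨ (b ==F I))
removed (suc m) (O ∷ y)      = removed m y
removed (suc m) (c ∷ y)      = c ==F lastCoord y

count-last-one : ∀ k → count (λ y → I ==F lastCoord y) (allVecs (suc k)) ≡ 4 ^ k
count-last-one zero    = refl
count-last-one (suc k) =
  trans (count-allVecs-suc {suc k} (λ y → I ==F lastCoord y))
        (cong (λ c → c + (c + (c + (c + 0)))) (count-last-one k))

card-removed : ∀ m → card (suc m) (removed m) ≡ [ m ]₄ + 1
card-removed zero    = refl
card-removed (suc m) = begin
  card (suc (suc m)) (removed (suc m))
    ≡⟨ count-points-suc (removed (suc m)) ⟩
  card (suc m) (removed m) + count (λ y → I ==F lastCoord y) (allVecs (suc (suc m)))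
    ≡⟨ cong₂ _+_ (card-removed m) (count-last-one (suc m)) ⟩
  ([ m ]₄ + 1) + 4 ^ suc m
    ≡⟨ +-assoc [ m ]₄ 1 (4 ^ suc m) ⟩
  [ m ]₄ + (1 + 4 ^ suc m)
    ≡⟨ cong ([ m ]₄ +_) (+-comm 1 (4 ^ suc m)) ⟩
  [ m ]₄ + (4 ^ suc m + 1)
    ≡⟨ +-assoc [ m ]₄ (4 ^ suc m) 1 ⟨
  ([ m ]₄ + 4 ^ suc m) + 1 ∎


hyperplane : (d : ℕ) → Vec (Vec F4 (suc d)) d
hyperplane zero    = []
hyperplane (suc d) = (I ∷ zeroV (suc d)) ∷ Data.Vec.map (O ∷_) (hyperplane d)

lincomb-shift : ∀ {n k} (cs : Vec F4 k) (vs : Vec (Vec F4 n) k) →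
                lincomb cs (Data.Vec.map (O ∷_) vs) ≡ O ∷ lincomb cs vs
lincomb-shift []       []       = refl
lincomb-shift (c ∷ cs) (v ∷ vs) rewrite lincomb-shift cs vs =
  cong (_∷ ((c ·V v) +V lincomb cs vs)) (trans (+F-identityʳ (c *F O)) (*F-zeroʳ c))

zero-multiple-add : ∀ {n} c (x : Vec F4 n) → (c ·V zeroV n) +V x ≡ x
zero-multiple-add c []      = refl
zero-multiple-add c (y ∷ x) = cong₂ _∷_ (cong (_+F y) (*F-zeroʳ c)) (zero-multiple-add c x)

lincomb-hyperplane : ∀ d (c : Vec F4 d) → lincomb c (hyperplane d) ≡ c ∷ʳ O
lincomb-hyperplane zero    []       = refl
lincomb-hyperplane (suc d) (c ∷ cs) rewrite lincomb-shift cs (hyperplane d) | lincomb-hyperplane d cs =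
  cong₂ _∷_ (trans (+F-identityʳ (c *F I)) (*F-identityʳ c)) (zero-multiple-add c (cs ∷ʳ O))

snoc-zero : ∀ {k} (c : Vec F4 k) → c ∷ʳ O ≡ zeroV (suc k) → c ≡ zeroV k
snoc-zero []      _ = refl
snoc-zero (x ∷ c) e = cong₂ _∷_ (∷-injectiveˡ e) (snoc-zero c (∷-injectiveʳ e))

hyperplane-independent : ∀ d → LinIndep (hyperplane d)
hyperplane-independent d c e = snoc-zero c (trans (sym (lincomb-hyperplane d c)) e)

lastCoord-snoc : ∀ {k} (c : Vec F4 k) y → lastCoord (c ∷ʳ y) ≡ y
lastCoord-snoc []      y = refl
lastCoord-snoc (x ∷ c) y = lastCoord-snoc c y

snoc-lastCoord : ∀ {k} (x : Vec F4 (suc k)) → Σ (Vec F4 k) λ c → c ∷ʳ lastCoord x ≡ x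
snoc-lastCoord {zero}  (x ∷ [])  = [] , refl
snoc-lastCoord {suc k} (x ∷ xs) with snoc-lastCoord xs
... | c , e = x ∷ c , cong (x ∷_) e

in-hyperplane : ∀ d {x : Vec F4 (suc d)} → inSpan (hyperplane d) x ≡ true ⇔ lastCoord x ≡ O
in-hyperplane d {x} = mk⇔ to from
  where
    to : inSpan (hyperplane d) x ≡ true → lastCoord x ≡ O
    to e with inSpan-sound (hyperplane d) e
    ... | c , refl = trans (cong lastCoord (lincomb-hyperplane d c)) (lastCoord-snoc c O)
    from : lastCoord x ≡ O → inSpan (hyperplane d) x ≡ true
    from l with snoc-lastCoord x
    ... | c , e = subst (λ z → inSpan (hyperplane d) z ≡ true)
                        (trans (lincomb-hyperplane d c) (trans (cong (c ∷ʳ_) (sym l)) e))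
                        (inSpan-complete (hyperplane d) c)

meetPoint : (m : ℕ) → Vec F4 (suc (suc m))
meetPoint zero    = I ∷ O ∷ []
meetPoint (suc m) = O ∷ meetPoint m

meetPoint-point : ∀ m → isPoint (meetPoint m) ≡ true
meetPoint-point zero    = refl
meetPoint-point (suc m) = meetPoint-point m

meetPoint-removed : ∀ m → removed m (meetPoint m) ≡ true
meetPoint-removed zero    = refl
meetPoint-removed (suc m) = meetPoint-removed m

meetPoint-last : ∀ m → lastCoord (meetPoint m) ≡ O
meetPoint-last zero    = refl
meetPoint-last (suc m) = meetPoint-last m

-- A removed point with last coordinate 0 is e: the affine points of R_m have last
-- coordinate 1, so such a point lies in x₀ = 0 all the way down to R_0.
removed-in-hyperplane : ∀ m {x} → isPoint x ≡ true → removed m x ≡ true → lastCoord x ≡ O → x ≡ meetPoint m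
removed-in-hyperplane zero    {a ∷ b ∷ []} _ r refl = cong (_∷ O ∷ []) (==F-sound (∧-conicalˡ (a ==F I) _ r))
removed-in-hyperplane (suc m) {O ∷ y}      p r l    = cong (O ∷_) (removed-in-hyperplane m p r l)
removed-in-hyperplane (suc m) {I ∷ y}      _ r l    = contradiction (trans (==F-sound r) l) λ ()

meets : ∀ m (x : Vec F4 (suc (suc m))) → isPoint x ≡ true →
        (removed m x ∧ inSpan (hyperplane (suc m)) x) ≡ inSpan (meetPoint m ∷ []) x
meets m x px = ⇔→≡ (mk⇔ to from)
  where
    to : (removed m x ∧ inSpan (hyperplane (suc m)) x) ≡ true → inSpan (meetPoint m ∷ []) x ≡ true
    to h with removed-in-hyperplane m px (∧-conicalˡ (removed m x) _ h)
                (Equivalence.to (in-hyperplane (suc m)) (∧-conicalʳ (removed m x) _ h))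
    ... | refl = span1-self (meetPoint m)
    from : inSpan (meetPoint m ∷ []) x ≡ true → (removed m x ∧ inSpan (hyperplane (suc m)) x) ≡ true
    from h with span1-point {v = meetPoint m} {x = x} (meetPoint-point m) px h
    ... | refl = cong₂ _∧_ (meetPoint-removed m) (Equivalence.from (in-hyperplane (suc m)) (meetPoint-last m))


retained-cong : ∀ {d} (R : PointSet d) (L L' : Vec (Vec F4 (suc d)) 2) → SameSpan L L' →
                retainedOn d R L ≡ retainedOn d R L'
retained-cong {d} R L L' same = count-cong (λ x → cong (_∧ not (R x)) (same x)) (points d)

-- Base case: PG_1(4) is a single line, and R_0 keeps 3 of its 5 points.  This is
-- checked by evaluation over all pairs of vectors of F₄²: each pair is either
-- linearly dependent (found by searching for a nontrivial vanishing combination)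
-- or spans a line keeping a number of points different from 2.
dependent? : ∀ {n k} → Vec (Vec F4 n) k → Bool
dependent? {n} {k} vs = any (λ c → not (c ==V zeroV k) ∧ (lincomb c vs ==V zeroV n)) (allVecs k)

independent⇒¬dependent : ∀ {n k} {vs : Vec (Vec F4 n) k} → LinIndep vs → dependent? vs ≡ false
independent⇒¬dependent {n} {k} {vs} li =
  ¬-not λ e → nontrivial-zero (satisfied (any⁻ _ (allVecs k) (Equivalence.from T-≡ e)))
  where
    nontrivial-zero : Σ (Vec F4 k) (λ c → T (not (c ==V zeroV k) ∧ (lincomb c vs ==V zeroV n))) → ⊥
    nontrivial-zero (c , h) with li c (==V-sound (∧-conicalʳ _ _ (Equivalence.to T-≡ h)))
    ... | refl = contradiction (trans (sym (cong not (==V-refl (zeroV k))))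
                                      (∧-conicalˡ _ _ (Equivalence.to T-≡ h))) λ ()

base-ok : Vec F4 2 → Vec F4 2 → Bool
base-ok a b = dependent? (a ∷ b ∷ []) ∨ not (retainedOn 1 (removed zero) (a ∷ b ∷ []) ≡ᵇ 2)

base-check : T (all (λ a → all (base-ok a) (allVecs 2)) (allVecs 2))
base-check = tt

legal-base : LegalTruncation 1 (removed zero)
legal-base (a ∷ b ∷ []) li e = subst (λ k → T (not (k ≡ᵇ 2))) e checked
  where
    entry : T (base-ok a b)
    entry = All.lookup (All.all⁺ (base-ok a) (allVecs 2)
                         (All.lookup (All.all⁺ (λ a → all (base-ok a) (allVecs 2)) (allVecs 2) base-check)
                                     (allVecs-complete 2 a)))
                       (allVecs-complete 2 b)
    checked : T (not (retainedOn 1 (removed zero) (a ∷ b ∷ []) ≡ᵇ 2))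
    checked = subst (λ d → T (d ∨ not (retainedOn 1 (removed zero) (a ∷ b ∷ []) ≡ᵇ 2)))
                    (independent⇒¬dependent li) entry

lin2-head-zero : ∀ {n} s t (a b : Vec F4 n) → lin2 s t (O ∷ a) (O ∷ b) ≡ O ∷ lin2 s t a b
lin2-head-zero s t a b = cong (_∷ lin2 s t a b) (cong₂ _+F_ (*F-zeroʳ s) (*F-zeroʳ t))

module InHyperplane {n} (a b : Vec F4 n) where

  span-head : ∀ {c y} → inSpan ((O ∷ a) ∷ (O ∷ b) ∷ []) (c ∷ y) ≡ true →
              c ≡ O × inSpan (a ∷ b ∷ []) y ≡ true
  span-head {c} {y} e with span2-sound (O ∷ a) (O ∷ b) {c ∷ y} e
  ... | s , t , eq with trans (sym (lin2-head-zero s t a b)) eq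
  ...   | refl = refl , span2-complete a b s t

  span-tail : ∀ y → inSpan ((O ∷ a) ∷ (O ∷ b) ∷ []) (O ∷ y) ≡ inSpan (a ∷ b ∷ []) y
  span-tail y = ⇔→≡ (mk⇔ (λ e → proj₂ (span-head {O} {y} e)) lift)
    where
      lift : inSpan (a ∷ b ∷ []) y ≡ true → inSpan ((O ∷ a) ∷ (O ∷ b) ∷ []) (O ∷ y) ≡ true
      lift e with span2-sound a b {y} e
      ... | s , t , refl = subst (λ x → inSpan ((O ∷ a) ∷ (O ∷ b) ∷ []) x ≡ true)
                                 (lin2-head-zero s t a b) (span2-complete (O ∷ a) (O ∷ b) s t)

  independent : LinIndep ((O ∷ a) ∷ (O ∷ b) ∷ []) → LinIndep (a ∷ b ∷ [])
  independent li (s ∷ t ∷ []) e =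
    li (s ∷ t ∷ []) (trans (lincomb-pair s t (O ∷ a) (O ∷ b))
                     (trans (lin2-head-zero s t a b) (cong (O ∷_) (trans (sym (lincomb-pair s t a b)) e))))

retained-in-hyperplane : ∀ {m} (a b : Vec F4 (suc (suc m))) →
  retainedOn (suc (suc m)) (removed (suc m)) ((O ∷ a) ∷ (O ∷ b) ∷ [])
  ≡ retainedOn (suc m) (removed m) (a ∷ b ∷ [])
retained-in-hyperplane {m} a b = begin
  retainedOn (suc (suc m)) (removed (suc m)) L
    ≡⟨ count-points-suc (λ x → inSpan L x ∧ not (removed (suc m) x)) ⟩
  count (λ y → inSpan L (O ∷ y) ∧ not (removed m y)) (points (suc m))
    + count (λ y → inSpan L (I ∷ y) ∧ not (removed (suc m) (I ∷ y))) (allVecs (suc (suc m)))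
    ≡⟨ cong₂ _+_ (count-cong (λ y → cong (_∧ not (removed m y)) (span-tail y)) (points (suc m)))
                 (count-none (λ y → cong (_∧ not (removed (suc m) (I ∷ y)))
                                         (¬-not (λ e → I≢O (proj₁ (span-head {I} {y} e)))))
                             (allVecs (suc (suc m)))) ⟩
  retainedOn (suc m) (removed m) (a ∷ b ∷ []) + 0
    ≡⟨ +-identityʳ _ ⟩
  retainedOn (suc m) (removed m) (a ∷ b ∷ []) ∎
  where
    open InHyperplane a b
    L = (O ∷ a) ∷ (O ∷ b) ∷ []
    I≢O : I ≢ O
    I≢O ()

normal-form : ∀ {n} a₀ b₀ (a' b' : Vec F4 n) → a₀ ≢ O → LinIndep ((a₀ ∷ a') ∷ (b₀ ∷ b') ∷ []) →
              Σ (Vec F4 n) λ u → Σ (Vec F4 n) λ v →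
                SameSpan ((a₀ ∷ a') ∷ (b₀ ∷ b') ∷ []) ((I ∷ u) ∷ (O ∷ v) ∷ []) × v ≢ replicate n O
normal-form a₀ b₀ a' b' a₀≢O li = u , v , same-span p O p' I a₀ O b₀ I hu hv ha hb , v≢0
  where
    a = a₀ ∷ a'
    b = b₀ ∷ b'
    p  = inv a₀
    p' = b₀ *F inv a₀
    u = lin2 p O a' b'
    v = lin2 p' I a' b'

    hu : I ∷ u ≡ lin2 p O a b
    hu = cong (_∷ u) (sym (trans (+F-identityʳ (p *F a₀)) (*F-inverseˡ a₀≢O)))

    hv : O ∷ v ≡ lin2 p' I a b
    hv = cong (_∷ v) (sym (begin
      (p' *F a₀) +F (I *F b₀)          ≡⟨ cong₂ _+F_ (*F-assoc b₀ (inv a₀) a₀) (*F-identityˡ b₀) ⟩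
      (b₀ *F (inv a₀ *F a₀)) +F b₀     ≡⟨ cong (λ z → (b₀ *F z) +F b₀) (*F-inverseˡ a₀≢O) ⟩
      (b₀ *F I) +F b₀                  ≡⟨ cong (_+F b₀) (*F-identityʳ b₀) ⟩
      b₀ +F b₀                         ≡⟨ +F-self b₀ ⟩
      O                                ∎))

    back : ∀ s t → lin2 s t (I ∷ u) (O ∷ v) ≡ lin2 ((s *F p) +F (t *F p')) ((s *F O) +F (t *F I)) a b
    back s t = trans (cong₂ (lin2 s t) hu hv) (lin2-lin2 s t p O p' I a b)

    ha : a ≡ lin2 a₀ O (I ∷ u) (O ∷ v)
    ha = sym (begin
      lin2 a₀ O (I ∷ u) (O ∷ v)
        ≡⟨ back a₀ O ⟩
      lin2 ((a₀ *F p) +F O) ((a₀ *F O) +F O) a b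
        ≡⟨ cong₂ (λ s t → lin2 s t a b) (trans (+F-identityʳ (a₀ *F p)) (*F-inverseʳ a₀≢O))
                                         (cong (_+F O) (*F-zeroʳ a₀)) ⟩
      lin2 I O a b
        ≡⟨ lin2-IO a b ⟩
      a ∎)

    hb : b ≡ lin2 b₀ I (I ∷ u) (O ∷ v)
    hb = sym (begin
      lin2 b₀ I (I ∷ u) (O ∷ v)
        ≡⟨ back b₀ I ⟩
      lin2 (p' +F (I *F p')) ((b₀ *F O) +F I) a b
        ≡⟨ cong₂ (λ s t → lin2 s t a b) (trans (cong (p' +F_) (*F-identityˡ p')) (+F-self p'))
                                         (cong (_+F I) (*F-zeroʳ b₀)) ⟩
      lin2 O I a b
        ≡⟨ lin2-OI a b ⟩
      b ∎)

    v≢0 : v ≢ replicate _ O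
    v≢0 v≡0 with li (p' ∷ I ∷ []) (trans (lincomb-pair p' I a b) (trans (sym hv) (cong (O ∷_) v≡0)))
    ... | ()

lin2-normal : ∀ {n} s t (u v : Vec F4 n) → lin2 s t (I ∷ u) (O ∷ v) ≡ s ∷ lin2 s t u v
lin2-normal s t u v =
  cong (_∷ lin2 s t u v) (trans (cong ((s *F I) +F_) (*F-zeroʳ t)) (trans (+F-identityʳ (s *F I)) (*F-identityʳ s)))

-- The affine point (1 : u + t·v) is kept iff α + t·β ≠ 1.
Avoids : F4 → F4 → F4 → Set
Avoids α β t = (I ==F ((I *F α) +F (t *F β))) ≡ false

ThreeAvoiding : F4 → F4 → Set
ThreeAvoiding α β = Σ F4 λ t₁ → Σ F4 λ t₂ → Σ F4 λ t₃ →
  t₁ ≢ t₂ × t₁ ≢ t₃ × t₂ ≢ t₃ × Avoids α β t₁ × Avoids α β t₂ × Avoids α β t₃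

three-avoiding : ∀ α β → ¬ (α ≡ I × β ≡ O) → ThreeAvoiding α β
three-avoiding O  O  _ = O , I , w  , (λ ()) , (λ ()) , (λ ()) , refl , refl , refl
three-avoiding O  I  _ = O , w , w² , (λ ()) , (λ ()) , (λ ()) , refl , refl , refl
three-avoiding O  w  _ = O , I , w  , (λ ()) , (λ ()) , (λ ()) , refl , refl , refl
three-avoiding O  w² _ = O , I , w² , (λ ()) , (λ ()) , (λ ()) , refl , refl , refl
three-avoiding I  O  h = ⊥-elim (h (refl , refl))
three-avoiding I  I  _ = I , w , w² , (λ ()) , (λ ()) , (λ ()) , refl , refl , refl
three-avoiding I  w  _ = I , w , w² , (λ ()) , (λ ()) , (λ ()) , refl , refl , refl
three-avoiding I  w² _ = I , w , w² , (λ ()) , (λ ()) , (λ ()) , refl , refl , refl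
three-avoiding w  O  _ = O , I , w  , (λ ()) , (λ ()) , (λ ()) , refl , refl , refl
three-avoiding w  I  _ = O , I , w  , (λ ()) , (λ ()) , (λ ()) , refl , refl , refl
three-avoiding w  w  _ = O , I , w² , (λ ()) , (λ ()) , (λ ()) , refl , refl , refl
three-avoiding w  w² _ = O , w , w² , (λ ()) , (λ ()) , (λ ()) , refl , refl , refl
three-avoiding w² O  _ = O , I , w  , (λ ()) , (λ ()) , (λ ()) , refl , refl , refl
three-avoiding w² I  _ = O , I , w² , (λ ()) , (λ ()) , (λ ()) , refl , refl , refl
three-avoiding w² w  _ = O , w , w² , (λ ()) , (λ ()) , (λ ()) , refl , refl , refl
three-avoiding w² w² _ = O , I , w  , (λ ()) , (λ ()) , (λ ()) , refl , refl , refl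

module NormalLine {m} (u v : Vec F4 (suc (suc m))) (v≢0 : v ≢ replicate (suc (suc m)) O) where

  L : Vec (Vec F4 (suc (suc (suc m)))) 2
  L = (I ∷ u) ∷ (O ∷ v) ∷ []

  kept? : Vec F4 (suc (suc (suc m))) → Bool
  kept? x = inSpan L x ∧ not (removed (suc m) x)

  kept : List (Vec F4 (suc (suc (suc m))))
  kept = filterᵇ kept? (points (suc (suc m)))

  on-line : ∀ s t → inSpan L (s ∷ lin2 s t u v) ≡ true
  on-line s t = subst (λ x → inSpan L x ≡ true) (lin2-normal s t u v) (span2-complete (I ∷ u) (O ∷ v) s t)

  line-point : ∀ {x} → inSpan L x ≡ true → Σ F4 λ s → Σ F4 λ t → x ≡ s ∷ lin2 s t u v
  line-point {x} e with span2-sound (I ∷ u) (O ∷ v) {x} e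
  ... | s , t , refl = s , t , lin2-normal s t u v

  affine-kept : ∀ t → Avoids (lastCoord u) (lastCoord v) t → (I ∷ lin2 I t u v) ∈ kept
  affine-kept t avoids =
    ∈-filter⁺ (T? ∘ kept?) (points-complete refl)
      (Equivalence.from T-≡ (cong₂ _∧_ (on-line I t)
                                       (cong not (trans (cong (I ==F_) (lastCoord-lin2 I t u v)) avoids))))

  at-least-three : ThreeAvoiding (lastCoord u) (lastCoord v) → 3 ≤ length kept
  at-least-three (t₁ , t₂ , t₃ , t₁≢t₂ , t₁≢t₃ , t₂≢t₃ , a₁ , a₂ , a₃) =
    three-distinct (affine-kept t₁ a₁) (affine-kept t₂ a₂) (affine-kept t₃ a₃)
                   (distinct t₁≢t₂) (distinct t₁≢t₃) (distinct t₂≢t₃)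
    where
      distinct : ∀ {t t'} → t ≢ t' → I ∷ lin2 I t u v ≢ I ∷ lin2 I t' u v
      distinct t≢t' e = t≢t' (lin2-injectiveʳ I u v v≢0 (∷-injectiveʳ e))

  -- When (α,β) = (1,0) all four affine points are removed.
  module AllAffineRemoved (α≡I : lastCoord u ≡ I) (β≡O : lastCoord v ≡ O) where

    at-infinity : ∀ {x} → x ∈ kept → Σ F4 λ t → x ≡ O ∷ (t ·V v) × isPoint (t ·V v) ≡ true
    at-infinity {x} x∈ with ∈-filter⁻ (T? ∘ kept?) {xs = points (suc (suc m))} x∈
    ... | x∈points , x-kept with ∈-filter⁻ (T? ∘ isPoint) {xs = allVecs _} x∈points
    ...   | _ , point with line-point {x} (∧-conicalˡ (inSpan L x) _ (Equivalence.to T-≡ x-kept))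
    ...     | O  , t , refl = t , cong (O ∷_) (lin2-zeroˡ t u v) ,
                              subst (λ z → isPoint z ≡ true) (lin2-zeroˡ t u v) (Equivalence.to T-≡ point)
    ...     | w  , t , refl = contradiction (Equivalence.to T-≡ point) λ ()
    ...     | w² , t , refl = contradiction (Equivalence.to T-≡ point) λ ()
    ...     | I  , t , refl = contradiction (∧-conicalʳ (inSpan L x) _ (Equivalence.to T-≡ x-kept))
                                            not-removed
      where
        removed-affine : (I ==F lastCoord (lin2 I t u v)) ≡ true
        removed-affine rewrite lastCoord-lin2 I t u v | α≡I | β≡O | *F-zeroʳ t = refl
        not-removed : not (I ==F lastCoord (lin2 I t u v)) ≢ true
        not-removed rewrite removed-affine = λ ()

    at-most-one-kept : length kept ≤ 1
    at-most-one-kept = at-most-one (Unique.filter⁺ (T? ∘ kept?) (points-unique (suc (suc m)))) same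
      where
        same : ∀ {x y} → x ∈ kept → y ∈ kept → x ≡ y
        same x∈ y∈ with at-infinity x∈ | at-infinity y∈
        ... | t , refl , px | t' , refl , py = cong (O ∷_) (normalised-unique t t' v px py)

  legal : retainedOn (suc (suc m)) (removed (suc m)) L ≢ 2
  legal with lastCoord u ≟F I | lastCoord v ≟F O
  ... | yes α≡I | yes β≡O = <⇒≢ (s≤s (AllAffineRemoved.at-most-one-kept α≡I β≡O))
  ... | no α≢I  | _       = ≢-sym (<⇒≢ (at-least-three (three-avoiding α β λ (α≡I , _) → α≢I α≡I)))
    where α = lastCoord u ; β = lastCoord v
  ... | yes _   | no β≢O  = ≢-sym (<⇒≢ (at-least-three (three-avoiding α β λ (_ , β≡O) → β≢O β≡O)))
    where α = lastCoord u ; β = lastCoord v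

legal-off-hyperplane : ∀ {m} a₀ b₀ (a' b' : Vec F4 (suc (suc m))) → a₀ ≢ O →
                       LinIndep ((a₀ ∷ a') ∷ (b₀ ∷ b') ∷ []) →
                       retainedOn (suc (suc m)) (removed (suc m)) ((a₀ ∷ a') ∷ (b₀ ∷ b') ∷ []) ≢ 2
legal-off-hyperplane {m} a₀ b₀ a' b' a₀≢O li e with normal-form a₀ b₀ a' b' a₀≢O li
... | u , v , same , v≢0 =
  NormalLine.legal u v v≢0
    (trans (sym (retained-cong (removed (suc m)) ((a₀ ∷ a') ∷ (b₀ ∷ b') ∷ []) ((I ∷ u) ∷ (O ∷ v) ∷ []) same)) e)

legal : ∀ m → LegalTruncation (suc m) (removed m)
legal zero = legal-base
legal (suc m) ((a₀ ∷ a') ∷ (b₀ ∷ b') ∷ []) li e with a₀ ≟F O | b₀ ≟F O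
... | no a₀≢O  | _        = legal-off-hyperplane a₀ b₀ a' b' a₀≢O li e
... | yes refl | no b₀≢O  =
  legal-off-hyperplane b₀ O b' a' b₀≢O (swap-independent li)
    (trans (sym (retained-cong (removed (suc m)) ((O ∷ a') ∷ (b₀ ∷ b') ∷ []) ((b₀ ∷ b') ∷ (O ∷ a') ∷ [])
                                (swap-span (O ∷ a') (b₀ ∷ b')))) e)
... | yes refl | yes refl =
  legal m (a' ∷ b' ∷ []) (InHyperplane.independent a' b' li) (trans (sym (retained-in-hyperplane {m} a' b')) e)


lemma4p2 : (d : ℕ) → 1 ≤ d → InS d 0 [ d ∸ 1 ]₄
lemma4p2 (suc m) _ =
  removed m , legal m , card-removed m ,
  hyperplane (suc m) , hyperplane-independent (suc m) ,
  meetPoint m ∷ [] , point-independent (meetPoint-point m) ,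
  meets m
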